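{- For every square matrix $A \in \mathbb{R}^{n \times n}$, \[ \rho_{\mathrm{per}}(A) + \eta_{\mathrm{per}}(A) \geq n . \]
   Context: The permanent of an $m\times m$ matrix $B=(b_{ij})$ is $\mathrm{per}(B)=\sum_{\sigma\in S_m}\prod_{i=1}^m b_{i,\sigma(i)}$. The permanental polynomial of $A\in\mathbb{R}^{n\times n}$ is $\pi(A,x)=\mathrm{per}(A-xI)$, where $I$ is the $n\times n$ identity. The permanental rank $\rho_{\mathrm{per}}(A)$ is the largest integer $k$ such that $A$ has a $k\times k$ submatrix $A[I,J]$ (rows indexed by $I$, columns by $J$, $|I|=|J|=k$, not necessarily $I=J$) with nonzero permanent. The permanental nullity $\eta_{\mathrm{per}}(A)$ is the multiplicity of $0$ as a root of $\pi(A,x)$. -}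

module Defs where

open import Level using (Level)
open import Algebra.Bundles using (CommutativeRing)
open import Data.Nat using (ℕ; zero; suc; _<_; _≤_)
open import Data.Fin as F using (Fin; zero; suc; punchIn)
open import Data.List using (List; []; _∷_; map; concatMap; foldr; allFin)
open import Data.Product using (_×_; Σ; ∃; _,_)
open import Relation.Nullary using (¬_)
open import Relation.Binary.PropositionalEquality using (_≡_)

-- All permutations of Fin m (the symmetric group S_m), as functions.
-- Each σ ∈ S_(m+1) is produced exactly once: j = σ 0, and
-- σ (suc i) = punchIn j (τ i) for a unique τ ∈ S_m.
perms : (m : ℕ) → List (Fin m → Fin m)
perms zero    = (λ ()) ∷ []
perms (suc m) = concatMap (λ τ → map (λ j → ext j τ) (allFin (suc m))) (perms m)
  where
  ext : Fin (suc m) → (Fin m → Fin m) → Fin (suc m) → Fin (suc m)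
  ext j τ zero    = j
  ext j τ (suc i) = punchIn j (τ i)

module Perm {a} {C : Set a} (_+_ _*_ : C → C → C) (0c 1c : C) where
  prodFin : (m : ℕ) → (Fin m → C) → C
  prodFin zero    f = 1c
  prodFin (suc m) f = f zero * prodFin m (λ i → f (suc i))

  per : (m : ℕ) → (Fin m → Fin m → C) → C
  per m B = foldr _+_ 0c (map (λ σ → prodFin m (λ i → B i (σ i))) (perms m))

module PermanentalRank {c ℓ} (R : CommutativeRing c ℓ) where
  open CommutativeRing R renaming (Carrier to K)

  -- Polynomials over K as coefficient lists (constant term first).
  Poly : Set c
  Poly = List K

  _⊕_ : Poly → Poly → Poly
  []       ⊕ q        = q
  (a ∷ p)  ⊕ []       = a ∷ p
  (a ∷ p)  ⊕ (b ∷ q)  = (a + b) ∷ (p ⊕ q)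

  scale : K → Poly → Poly
  scale a = map (a *_)

  _⊗_ : Poly → Poly → Poly
  []      ⊗ q = []
  (a ∷ p) ⊗ q = scale a q ⊕ (0# ∷ (p ⊗ q))

  constP : K → Poly
  constP a = a ∷ []

  X : Poly
  X = 0# ∷ 1# ∷ []

  coeff : Poly → ℕ → K
  coeff []      _       = 0#
  coeff (a ∷ p) zero    = a
  coeff (a ∷ p) (suc i) = coeff p i

  perK : (m : ℕ) → (Fin m → Fin m → K) → K
  perK = Perm.per _+_ _*_ 0# 1#

  perP : (m : ℕ) → (Fin m → Fin m → Poly) → Poly
  perP = Perm.per _⊕_ _⊗_ [] (constP 1#)

  δ : ∀ {n} → Fin n → Fin n → K
  δ i j with i F.≟ j
  ... | Relation.Nullary.yes _ = 1#
  ... | Relation.Nullary.no  _ = 0#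

  permPoly : (n : ℕ) → (Fin n → Fin n → K) → Poly
  permPoly n A = perP n (λ i j → constP (A i j) ⊕ scale (- δ i j) X)

  -- η is the multiplicity of 0 as a root of π(A,x): x^η divides π
  -- (coefficients 0..η−1 vanish) and x^(η+1) does not (coefficient η ≠ 0).
  IsPerNullity : (n : ℕ) → (Fin n → Fin n → K) → ℕ → Set ℓ
  IsPerNullity n A η =
    ((i : ℕ) → i < η → coeff (permPoly n A) i ≈ 0#) × ¬ (coeff (permPoly n A) η ≈ 0#)

  -- a k-element subset of Fin n, as a strictly increasing map Fin k → Fin n
  Subset : ℕ → ℕ → Set
  Subset k n = Σ (Fin k → Fin n) (λ f → (i j : Fin k) → i F.< j → f i F.< f j)

  HasNonzeroMinor : (n : ℕ) → (Fin n → Fin n → K) → ℕ → Set ℓ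
  HasNonzeroMinor n A k =
    Σ (Subset k n) λ I → Σ (Subset k n) λ J →
      ¬ (perK k (λ i j → A (Data.Product.proj₁ I i) (Data.Product.proj₁ J j)) ≈ 0#)

  IsPerRank : (n : ℕ) → (Fin n → Fin n → K) → ℕ → Set ℓ
  IsPerRank n A ρ = HasNonzeroMinor n A ρ × ((k : ℕ) → HasNonzeroMinor n A k → k ≤ ρ)

  -- K is a field: 1 ≠ 0 and every nonzero element has a multiplicative inverse
  -- (ℝ is such a field).
  IsField : Set (c Level.⊔ ℓ)
  IsField = ¬ (1# ≈ 0#) × ((a : K) → ¬ (a ≈ 0#) → Σ K (λ b → (a * b) ≈ 1#))

{-# OPTIONS --safe #-}
-- The coefficient of x^t in per(A − xI) = per(A + x(−I)) is, by multilinearity of the permanent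
-- in the rows, the sum over all t-element sets S of rows of the permanent of the matrix taking
-- the rows in S from −I and the other n − t rows from A. Laplace expansion along the rows in S
-- writes each of these as a combination of permanents of (n − t) × (n − t) submatrices of A,
-- which vanish as soon as n − t > ρ. Hence n > ρ + η would make the coefficient of x^η vanish.
module Submission where

open import Defs
open import Level using (Level)
open import Algebra.Bundles using (CommutativeMonoid; CommutativeRing)
open import Data.Bool.Base using (Bool; true; false; if_then_else_)
import Data.Bool.Properties as Boolₚ
open import Data.Empty using (⊥-elim)
open import Data.Fin.Base as Fin using (Fin; zero; suc; punchIn; punchOut)
import Data.Fin.Properties as Finₚ
open import Data.List.Base using (List; []; _∷_; _++_; map; foldr; concatMap; allFin; tabulate)
import Data.List.Properties as Listₚ
open import Data.List.Relation.Unary.All as All using (All; []; _∷_)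
import Data.List.Relation.Unary.All.Properties as Allₚ
open import Data.Nat.Base as ℕ using (ℕ; zero; suc; _≤_)
import Data.Nat.Properties as ℕₚ
open import Data.Product using (_,_; proj₁)
import Data.Vec.Functional as Vector
open import Function.Base using (_∘_; id; flip)
open import Relation.Nullary using (¬_; yes; no)
open import Relation.Nullary.Negation using (¬¬-map)
open import Relation.Binary.PropositionalEquality as ≡ using (_≡_; _≢_; _≗_)

¬¬-zipWith : ∀ {a b c} {A : Set a} {B : Set b} {C : Set c} →
             (A → B → C) → ¬ ¬ A → ¬ ¬ B → ¬ ¬ C
¬¬-zipWith f ¬¬a ¬¬b ¬c = ¬¬a (λ a → ¬¬b (λ b → ¬c (f a b)))

punchIn-mono-< : ∀ {m} (i : Fin (suc m)) {j k : Fin m} →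
                 j Fin.< k → punchIn i j Fin.< punchIn i k
punchIn-mono-< i {j} {k} j<k =
  ℕₚ.≰⇒> (λ k′≤j′ → ℕₚ.<⇒≱ j<k (Finₚ.punchIn-cancel-≤ i k j k′≤j′))

-- Both sides enumerate Fin (2 + m) ∖ {j , j′} in increasing order.
punchIn-punchOut-comm : ∀ {m} {j j′ : Fin (suc (suc m))} (j≢j′ : j ≢ j′) (j′≢j : j′ ≢ j) →
                        punchIn j  ∘ punchIn (punchOut j≢j′)
                        ≗ punchIn j′ ∘ punchIn (punchOut j′≢j)
punchIn-punchOut-comm {j = zero}  {zero}   j≢j′ _ _ = ⊥-elim (j≢j′ ≡.refl)
punchIn-punchOut-comm {j = zero}  {suc j′} _    _ _ = ≡.refl
punchIn-punchOut-comm {j = suc j} {zero}   _    _ _ = ≡.refl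
punchIn-punchOut-comm {suc m} {suc j} {suc j′} _ _ zero    = ≡.refl
punchIn-punchOut-comm {suc m} {suc j} {suc j′} _ _ (suc w) =
  ≡.cong suc (punchIn-punchOut-comm _ _ w)

-- The t-element subsets of Fin m, as characteristic functions.
selections : (m t : ℕ) → List (Fin m → Bool)
selections zero    zero    = Vector.[] ∷ []
selections zero    (suc t) = []
selections (suc m) zero    = map (Vector._∷_ false) (selections m zero)
selections (suc m) (suc t) =
  map (Vector._∷_ false) (selections m (suc t)) ++ map (Vector._∷_ true) (selections m t)

falseCount : ∀ {m} → (Fin m → Bool) → ℕ
falseCount {zero}  s = 0
falseCount {suc m} s = if s zero then falseCount (s ∘ suc) else suc (falseCount (s ∘ suc))

falseCount-punchIn : ∀ {m} (s : Fin (suc m) → Bool) i → s i ≡ true →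
                     falseCount (s ∘ punchIn i) ≡ falseCount s
falseCount-punchIn s zero sᵢ rewrite sᵢ = ≡.refl
falseCount-punchIn {suc m} s (suc i) sᵢ =
  ≡.cong (λ n → if s zero then n else suc n) (falseCount-punchIn (s ∘ suc) i sᵢ)

falseCount-allFalse : ∀ {m} (s : Fin m → Bool) → (∀ i → s i ≡ false) → falseCount s ≡ m
falseCount-allFalse {zero}  s all-false = ≡.refl
falseCount-allFalse {suc m} s all-false rewrite all-false zero =
  ≡.cong suc (falseCount-allFalse (s ∘ suc) (all-false ∘ suc))

selections-falseCount : ∀ m t → All (λ s → falseCount s ℕ.+ t ≡ m) (selections m t)
selections-falseCount zero    zero    = ≡.refl ∷ []
selections-falseCount zero    (suc t) = []
selections-falseCount (suc m) zero    =
  Allₚ.map⁺ (All.map (≡.cong suc) (selections-falseCount m zero))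
selections-falseCount (suc m) (suc t) =
  Allₚ.++⁺ (Allₚ.map⁺ (All.map (≡.cong suc) (selections-falseCount m (suc t))))
           (Allₚ.map⁺ (All.map (λ {s} e → ≡.trans (ℕₚ.+-suc (falseCount s) t) (≡.cong suc e))
                               (selections-falseCount m t)))

module Sums {a ℓ} (M : CommutativeMonoid a ℓ) where
  open CommutativeMonoid M renaming
    (_∙_ to _+_; ε to 0#; ∙-cong to +-cong; ∙-congˡ to +-congˡ;
     identityˡ to +-identityˡ; identityʳ to +-identityʳ; assoc to +-assoc)
  open import Algebra.Properties.CommutativeMonoid.Sum M
    using (sum; sum-syntax; sum-cong-≋; sum-remove; ∑-comm)
  open import Algebra.Properties.CommutativeSemigroup commutativeSemigroup using (interchange)
  open import Relation.Binary.Reasoning.Setoid setoid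

  private
    variable
      b c : Level
      B : Set b
      C : Set c

  sumₗ : (B → Carrier) → List B → Carrier
  sumₗ f xs = foldr _+_ 0# (map f xs)

  sumₗ-cong : ∀ {f g : B → Carrier} xs → (∀ x → f x ≈ g x) → sumₗ f xs ≈ sumₗ g xs
  sumₗ-cong []       f≈g = refl
  sumₗ-cong (x ∷ xs) f≈g = +-cong (f≈g x) (sumₗ-cong xs f≈g)

  sumₗ-map : ∀ (f : C → Carrier) (g : B → C) xs → sumₗ f (map g xs) ≡ sumₗ (f ∘ g) xs
  sumₗ-map f g xs = ≡.cong (foldr _+_ 0#) (≡.sym (Listₚ.map-∘ xs))

  sumₗ-++ : ∀ (f : B → Carrier) xs ys → sumₗ f (xs ++ ys) ≈ sumₗ f xs + sumₗ f ys
  sumₗ-++ f []       ys = sym (+-identityˡ _)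
  sumₗ-++ f (x ∷ xs) ys = trans (+-congˡ (sumₗ-++ f xs ys)) (sym (+-assoc _ _ _))

  sumₗ-concatMap : ∀ (f : C → Carrier) (g : B → List C) xs →
                   sumₗ f (concatMap g xs) ≈ sumₗ (sumₗ f ∘ g) xs
  sumₗ-concatMap f g []       = refl
  sumₗ-concatMap f g (x ∷ xs) = trans (sumₗ-++ f (g x) _) (+-congˡ (sumₗ-concatMap f g xs))

  sumₗ-zero : ∀ (xs : List B) → sumₗ (λ _ → 0#) xs ≈ 0#
  sumₗ-zero []       = refl
  sumₗ-zero (x ∷ xs) = trans (+-congˡ (sumₗ-zero xs)) (+-identityʳ 0#)

  sumₗ-distrib-+ : ∀ (f g : B → Carrier) xs → sumₗ (λ x → f x + g x) xs ≈ sumₗ f xs + sumₗ g xs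
  sumₗ-distrib-+ f g []       = sym (+-identityˡ 0#)
  sumₗ-distrib-+ f g (x ∷ xs) =
    trans (+-congˡ (sumₗ-distrib-+ f g xs)) (interchange (f x) (g x) (sumₗ f xs) (sumₗ g xs))

  sumₗ-comm : ∀ (f : B → C → Carrier) xs ys →
              sumₗ (λ x → sumₗ (f x) ys) xs ≈ sumₗ (λ y → sumₗ (λ x → f x y) xs) ys
  sumₗ-comm f []       ys = sym (sumₗ-zero ys)
  sumₗ-comm f (x ∷ xs) ys =
    trans (+-congˡ (sumₗ-comm f xs ys)) (sym (sumₗ-distrib-+ (f x) _ ys))

  sumₗ-tabulate : ∀ (f : B → Carrier) {m} (g : Fin m → B) → sumₗ f (tabulate g) ≡ sum (f ∘ g)
  sumₗ-tabulate f {zero}  g = ≡.refl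
  sumₗ-tabulate f {suc m} g = ≡.cong (f (g zero) +_) (sumₗ-tabulate f (g ∘ suc))

  sumₗ-¬¬0 : ∀ {f : B → Carrier} {xs} → All (λ x → ¬ ¬ (f x ≈ 0#)) xs → ¬ ¬ (sumₗ f xs ≈ 0#)
  sumₗ-¬¬0 []             = λ ≉0 → ≉0 refl
  sumₗ-¬¬0 (¬¬fx≈0 ∷ all) =
    ¬¬-zipWith (λ e e′ → trans (+-cong e e′) (+-identityʳ 0#)) ¬¬fx≈0 (sumₗ-¬¬0 all)

  sum-¬¬0 : ∀ {m} {f : Fin m → Carrier} → (∀ j → ¬ ¬ (f j ≈ 0#)) → ¬ ¬ (sum f ≈ 0#)
  sum-¬¬0 {f = f} h =
    ≡.subst (λ x → ¬ ¬ (x ≈ 0#)) (sumₗ-tabulate f id) (sumₗ-¬¬0 (Allₚ.tabulate⁺ h))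

  -- perms lists σ ∈ S_(1+m) as the pairs (σ 0 , τ ∈ S_m) with σ ∘ suc = punchIn (σ 0) ∘ τ.
  sumₗ-perms-suc : ∀ m (F : Fin (suc m) → (Fin m → Fin (suc m)) → Carrier) →
                   sumₗ (λ σ → F (σ zero) (σ ∘ suc)) (perms (suc m))
                   ≈ ∑[ j < suc m ] sumₗ (λ τ → F j (punchIn j ∘ τ)) (perms m)
  sumₗ-perms-suc m F = begin
    sumₗ (λ σ → F (σ zero) (σ ∘ suc)) (perms (suc m))
      ≈⟨ sumₗ-concatMap _ _ (perms m) ⟩
    sumₗ (λ τ → sumₗ (λ σ → F (σ zero) (σ ∘ suc)) (map _ (allFin (suc m)))) (perms m)
      ≈⟨ sumₗ-cong (perms m) (λ τ → reflexive (sumₗ-map _ _ (allFin (suc m)))) ⟩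
    sumₗ (λ τ → sumₗ (λ j → F j (punchIn j ∘ τ)) (allFin (suc m))) (perms m)
      ≈⟨ sumₗ-comm (λ τ j → F j (punchIn j ∘ τ)) (perms m) (allFin (suc m)) ⟩
    sumₗ (λ j → sumₗ (λ τ → F j (punchIn j ∘ τ)) (perms m)) (allFin (suc m))
      ≡⟨ sumₗ-tabulate (λ j → sumₗ (λ τ → F j (punchIn j ∘ τ)) (perms m)) id ⟩
    ∑[ j < suc m ] sumₗ (λ τ → F j (punchIn j ∘ τ)) (perms m) ∎

  private
    OnPairs : ℕ → Set a
    OnPairs m = Fin (suc (suc m)) → Fin (suc (suc m)) → (Fin m → Fin (suc (suc m))) → Carrier

    offDiagonal : ∀ {m} → OnPairs m → Fin (suc (suc m)) → Fin (suc (suc m)) → Carrier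
    offDiagonal G j j′ with j Finₚ.≟ j′
    ... | yes _    = 0#
    ... | no j≢j′ = G j j′ (punchIn j ∘ punchIn (punchOut j≢j′))

    offDiagonal-row : ∀ {m} (G : OnPairs m) →
                      (∀ j j′ {c c′} → c ≗ c′ → G j j′ c ≈ G j j′ c′) →
                      ∀ j → ∑[ j′ < suc (suc m) ] offDiagonal G j j′
                            ≈ ∑[ l < suc m ] G j (punchIn j l) (punchIn j ∘ punchIn l)
    offDiagonal-row {m} G G-cong j = begin
      ∑[ j′ < suc (suc m) ] offDiagonal G j j′
        ≈⟨ sum-remove {i = j} (offDiagonal G j) ⟩
      offDiagonal G j j + ∑[ l < suc m ] offDiagonal G j (punchIn j l)
        ≈⟨ +-cong diagonal (sum-cong-≋ off) ⟩
      0# + ∑[ l < suc m ] G j (punchIn j l) (punchIn j ∘ punchIn l)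
        ≈⟨ +-identityˡ _ ⟩
      ∑[ l < suc m ] G j (punchIn j l) (punchIn j ∘ punchIn l) ∎
      where
      diagonal : offDiagonal G j j ≈ 0#
      diagonal with j Finₚ.≟ j
      ... | yes _   = refl
      ... | no j≢j = ⊥-elim (j≢j ≡.refl)
      off : ∀ l → offDiagonal G j (punchIn j l) ≈ G j (punchIn j l) (punchIn j ∘ punchIn l)
      off l with j Finₚ.≟ punchIn j l
      ... | yes j≡j′ = ⊥-elim (Finₚ.punchInᵢ≢i j l (≡.sym j≡j′))
      ... | no j≢j′ = G-cong _ _ (λ w → ≡.cong (λ l′ → punchIn j (punchIn l′ w))
                        (≡.trans (Finₚ.punchOut-cong j ≡.refl) (Finₚ.punchOut-punchIn j)))

  module _ {m} (G : OnPairs m) (G-cong : ∀ j j′ {c c′} → c ≗ c′ → G j j′ c ≈ G j j′ c′) where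

    private
      offDiagonal-flip : ∀ j j′ → offDiagonal G j j′ ≈ offDiagonal (flip G) j′ j
      offDiagonal-flip j j′ with j Finₚ.≟ j′ | j′ Finₚ.≟ j
      ... | yes _    | yes _    = refl
      ... | yes j≡j′ | no j′≢j  = ⊥-elim (j′≢j (≡.sym j≡j′))
      ... | no j≢j′  | yes j′≡j = ⊥-elim (j≢j′ (≡.sym j′≡j))
      ... | no j≢j′  | no j′≢j  = G-cong j j′ (punchIn-punchOut-comm j≢j′ j′≢j)

    -- Both sides sum G j j′ c over the ordered pairs j ≢ j′, c enumerating the remaining indices.
    ∑-distinctPairs-swap :
      ∑[ j < suc (suc m) ] ∑[ l < suc m ] G j (punchIn j l) (punchIn j ∘ punchIn l)
      ≈ ∑[ j < suc (suc m) ] ∑[ l < suc m ] G (punchIn j l) j (punchIn j ∘ punchIn l)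
    ∑-distinctPairs-swap = begin
      ∑[ j < suc (suc m) ] ∑[ l < suc m ] G j (punchIn j l) (punchIn j ∘ punchIn l)
        ≈⟨ sum-cong-≋ (offDiagonal-row G G-cong) ⟨
      ∑[ j < suc (suc m) ] ∑[ j′ < suc (suc m) ] offDiagonal G j j′
        ≈⟨ ∑-comm (offDiagonal G) ⟩
      ∑[ j′ < suc (suc m) ] ∑[ j < suc (suc m) ] offDiagonal G j j′
        ≈⟨ sum-cong-≋ (λ j′ → sum-cong-≋ (λ j → offDiagonal-flip j j′)) ⟩
      ∑[ j′ < suc (suc m) ] ∑[ j < suc (suc m) ] offDiagonal (flip G) j′ j
        ≈⟨ sum-cong-≋ (offDiagonal-row (flip G) (λ j j′ → G-cong j′ j)) ⟩
      ∑[ j < suc (suc m) ] ∑[ l < suc m ] G (punchIn j l) j (punchIn j ∘ punchIn l) ∎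

module Permanent {c ℓ} (R : CommutativeRing c ℓ) where
  open CommutativeRing R hiding (zero)
  open PermanentalRank R
  open Sums +-commutativeMonoid
  open import Algebra.Properties.Semiring.Sum semiring
    using (sum; sum-syntax; sum-cong-≋; *-distribˡ-sum)
  open import Relation.Binary.Reasoning.Setoid setoid

  Matrix : ℕ → Set c
  Matrix m = Fin m → Fin m → Carrier

  *-distribˡ-sumₗ : ∀ {b} {B : Set b} a (f : B → Carrier) xs →
                    a * sumₗ f xs ≈ sumₗ (λ x → a * f x) xs
  *-distribˡ-sumₗ a f []       = zeroʳ a
  *-distribˡ-sumₗ a f (x ∷ xs) = trans (distribˡ a _ _) (+-congˡ (*-distribˡ-sumₗ a f xs))

  prod : (m : ℕ) → (Fin m → Carrier) → Carrier
  prod = Perm.prodFin _+_ _*_ 0# 1#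

  prod-cong : ∀ {m} {f g : Fin m → Carrier} → (∀ i → f i ≈ g i) → prod m f ≈ prod m g
  prod-cong {zero}  f≈g = refl
  prod-cong {suc m} f≈g = *-cong (f≈g zero) (prod-cong (f≈g ∘ suc))

  perK-cong : ∀ {m} {B C : Matrix m} → (∀ i j → B i j ≈ C i j) → perK m B ≈ perK m C
  perK-cong {m} B≈C = sumₗ-cong (perms m) (λ σ → prod-cong (λ i → B≈C i (σ i)))

  minor : ∀ {m} → Matrix (suc m) → Fin (suc m) → Fin (suc m) → Matrix m
  minor B i j u l = B (punchIn i u) (punchIn j l)

  perK-expand-row₀ : ∀ {m} (B : Matrix (suc m)) →
                     perK (suc m) B ≈ ∑[ j < suc m ] (B zero j * perK m (minor B zero j))
  perK-expand-row₀ {m} B = begin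
    perK (suc m) B
      ≈⟨ sumₗ-perms-suc m (λ j τ → B zero j * prod m (λ i → B (suc i) (τ i))) ⟩
    ∑[ j < suc m ] sumₗ (λ τ → B zero j * term j τ) (perms m)
      ≈⟨ sum-cong-≋ (λ j → sym (*-distribˡ-sumₗ (B zero j) (term j) (perms m))) ⟩
    ∑[ j < suc m ] (B zero j * perK m (minor B zero j)) ∎
    where
    term : Fin (suc m) → (Fin m → Fin m) → Carrier
    term j τ = prod m (λ i → minor B zero j i (τ i))

  -- Expanding along row 0 and then along row 1 + i, or in the other order, gives the same
  -- double sum over pairs of distinct columns.
  perK-expand-row : ∀ {m} (i : Fin (suc m)) (B : Matrix (suc m)) →
                    perK (suc m) B ≈ ∑[ j < suc m ] (B i j * perK m (minor B i j))
  perK-expand-row zero B = perK-expand-row₀ B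
  perK-expand-row {suc m} (suc i) B = begin
    perK (suc (suc m)) B
      ≈⟨ perK-expand-row₀ B ⟩
    ∑[ j < suc (suc m) ] (B zero j * perK (suc m) (minor B zero j))
      ≈⟨ sum-cong-≋ (λ j → *-congˡ {B zero j} (perK-expand-row i (minor B zero j))) ⟩
    ∑[ j < suc (suc m) ] (B zero j * ∑[ l < suc m ] (B (suc i) (punchIn j l) * P j l))
      ≈⟨ sum-cong-≋ distribute₀ ⟩
    ∑[ j < suc (suc m) ] ∑[ l < suc m ] G j (punchIn j l) (punchIn j ∘ punchIn l)
      ≈⟨ ∑-distinctPairs-swap G G-cong ⟩
    ∑[ j < suc (suc m) ] ∑[ l < suc m ] G (punchIn j l) j (punchIn j ∘ punchIn l)
      ≈⟨ sum-cong-≋ factorᵢ ⟩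
    ∑[ j < suc (suc m) ] (B (suc i) j * ∑[ l < suc m ] (B zero (punchIn j l) * P j l))
      ≈⟨ sum-cong-≋ (λ j → *-congˡ {B (suc i) j} (sym (perK-expand-row₀ (minor B (suc i) j)))) ⟩
    ∑[ j < suc (suc m) ] (B (suc i) j * perK (suc m) (minor B (suc i) j)) ∎
    where
    perᵢ : (Fin m → Fin (suc (suc m))) → Carrier
    perᵢ cols = perK m (λ u w → B (suc (punchIn i u)) (cols w))
    P : Fin (suc (suc m)) → Fin (suc m) → Carrier
    P j l = perᵢ (punchIn j ∘ punchIn l)
    G : Fin (suc (suc m)) → Fin (suc (suc m)) → (Fin m → Fin (suc (suc m))) → Carrier
    G j j′ cols = (B zero j * B (suc i) j′) * perᵢ cols
    G-cong : ∀ j j′ {c c′} → c ≗ c′ → G j j′ c ≈ G j j′ c′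
    G-cong j j′ c≗c′ = *-congˡ (perK-cong (λ u w → reflexive (≡.cong (B _) (c≗c′ w))))
    distribute₀ : ∀ j → B zero j * ∑[ l < suc m ] (B (suc i) (punchIn j l) * P j l)
                        ≈ ∑[ l < suc m ] G j (punchIn j l) (punchIn j ∘ punchIn l)
    distribute₀ j =
      trans (*-distribˡ-sum (B zero j) (λ l → B (suc i) (punchIn j l) * P j l))
            (sum-cong-≋ (λ l → sym (*-assoc (B zero j) (B (suc i) (punchIn j l)) (P j l))))
    factorᵢ : ∀ j → ∑[ l < suc m ] G (punchIn j l) j (punchIn j ∘ punchIn l)
                    ≈ B (suc i) j * ∑[ l < suc m ] (B zero (punchIn j l) * P j l)
    factorᵢ j =
      trans (sum-cong-≋ (λ l → trans (*-congʳ (*-comm (B zero (punchIn j l)) (B (suc i) j)))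
                                     (*-assoc _ _ (P j l))))
            (sym (*-distribˡ-sum (B (suc i) j) (λ l → B zero (punchIn j l) * P j l)))

  coeff-⊕ : ∀ p q t → coeff (p ⊕ q) t ≈ coeff p t + coeff q t
  coeff-⊕ []      q       t       = sym (+-identityˡ _)
  coeff-⊕ (a ∷ p) []      t       = sym (+-identityʳ _)
  coeff-⊕ (a ∷ p) (b ∷ q) zero    = refl
  coeff-⊕ (a ∷ p) (b ∷ q) (suc t) = coeff-⊕ p q t

  coeff-scale : ∀ a q t → coeff (scale a q) t ≈ a * coeff q t
  coeff-scale a []      t       = sym (zeroʳ a)
  coeff-scale a (b ∷ q) zero    = refl
  coeff-scale a (b ∷ q) (suc t) = coeff-scale a q t

  coeff-sumₗ : ∀ {b} {B : Set b} (f : B → Poly) xs t →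
               coeff (foldr _⊕_ [] (map f xs)) t ≈ sumₗ (λ x → coeff (f x) t) xs
  coeff-sumₗ f []       t = refl
  coeff-sumₗ f (x ∷ xs) t = trans (coeff-⊕ (f x) _ t) (+-congˡ (coeff-sumₗ f xs t))

  coeff-linear-⊗-zero : ∀ α β q → coeff ((α ∷ β ∷ []) ⊗ q) zero ≈ α * coeff q zero
  coeff-linear-⊗-zero α β q = begin
    coeff (scale α q ⊕ (0# ∷ _)) zero ≈⟨ coeff-⊕ (scale α q) _ zero ⟩
    coeff (scale α q) zero + 0#       ≈⟨ +-identityʳ _ ⟩
    coeff (scale α q) zero            ≈⟨ coeff-scale α q zero ⟩
    α * coeff q zero                  ∎

  coeff-linear-⊗-suc : ∀ α β q t →
                       coeff ((α ∷ β ∷ []) ⊗ q) (suc t) ≈ α * coeff q (suc t) + β * coeff q t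
  coeff-linear-⊗-suc α β q t = begin
    coeff (scale α q ⊕ (0# ∷ (scale β q ⊕ (0# ∷ [])))) (suc t)
      ≈⟨ coeff-⊕ (scale α q) _ (suc t) ⟩
    coeff (scale α q) (suc t) + coeff (scale β q ⊕ (0# ∷ [])) t
      ≈⟨ +-cong (coeff-scale α q (suc t)) (coeff-⊕ (scale β q) _ t) ⟩
    α * coeff q (suc t) + (coeff (scale β q) t + coeff (0# ∷ []) t)
      ≈⟨ +-congˡ (trans (+-cong (coeff-scale β q t) (coeff-0 t)) (+-identityʳ _)) ⟩
    α * coeff q (suc t) + β * coeff q t ∎
    where
    coeff-0 : ∀ t → coeff (0# ∷ []) t ≈ 0#
    coeff-0 zero    = refl
    coeff-0 (suc t) = refl

  prodP : (m : ℕ) → (Fin m → Poly) → Poly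
  prodP = Perm.prodFin _⊕_ _⊗_ [] (constP 1#)

  chosenProd : ∀ {m} → (α β : Fin m → Carrier) → (Fin m → Bool) → Carrier
  chosenProd {m} α β s = prod m (λ i → if s i then β i else α i)

  coeff-prodP-linear : ∀ m (α β : Fin m → Carrier) t →
                       coeff (prodP m (λ i → α i ∷ β i ∷ [])) t
                       ≈ sumₗ (chosenProd α β) (selections m t)
  coeff-prodP-linear zero    α β zero    = sym (+-identityʳ 1#)
  coeff-prodP-linear zero    α β (suc t) = refl
  coeff-prodP-linear (suc m) α β t       = induction-step t
    where
    Q : Poly
    Q = prodP m (λ i → α (suc i) ∷ β (suc i) ∷ [])
    chosen : (Fin m → Bool) → Carrier
    chosen = chosenProd (α ∘ suc) (β ∘ suc)
    first-factor : ∀ x t → (if x then β zero else α zero) * coeff Q t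
                           ≈ sumₗ (chosenProd α β) (map (Vector._∷_ x) (selections m t))
    first-factor x t = begin
      a * coeff Q t
        ≈⟨ *-congˡ (coeff-prodP-linear m (α ∘ suc) (β ∘ suc) t) ⟩
      a * sumₗ chosen (selections m t)
        ≈⟨ *-distribˡ-sumₗ a chosen (selections m t) ⟩
      sumₗ (λ s → a * chosen s) (selections m t)
        ≡⟨ sumₗ-map (chosenProd α β) (Vector._∷_ x) (selections m t) ⟨
      sumₗ (chosenProd α β) (map (Vector._∷_ x) (selections m t)) ∎
      where
      a : Carrier
      a = if x then β zero else α zero
    induction-step : ∀ t → coeff (prodP (suc m) (λ i → α i ∷ β i ∷ [])) t
                           ≈ sumₗ (chosenProd α β) (selections (suc m) t)
    induction-step zero    =
      trans (coeff-linear-⊗-zero (α zero) (β zero) Q) (first-factor false zero)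
    induction-step (suc t) = begin
      coeff (prodP (suc m) (λ i → α i ∷ β i ∷ [])) (suc t)
        ≈⟨ coeff-linear-⊗-suc (α zero) (β zero) Q t ⟩
      α zero * coeff Q (suc t) + β zero * coeff Q t
        ≈⟨ +-cong (first-factor false (suc t)) (first-factor true t) ⟩
      sumₗ (chosenProd α β) (map (Vector._∷_ false) (selections m (suc t)))
        + sumₗ (chosenProd α β) (map (Vector._∷_ true) (selections m t))
        ≈⟨ sumₗ-++ (chosenProd α β) (map (Vector._∷_ false) (selections m (suc t))) _ ⟨
      sumₗ (chosenProd α β) (selections (suc m) (suc t)) ∎

  mixRows : ∀ {m} → (Fin m → Bool) → (a b : Matrix m) → Matrix m
  mixRows s a b i j = if s i then b i j else a i j

  coeff-perP-linear : ∀ m (a b : Matrix m) t →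
                      coeff (perP m (λ i j → a i j ∷ b i j ∷ [])) t
                      ≈ sumₗ (λ s → perK m (mixRows s a b)) (selections m t)
  coeff-perP-linear m a b t = begin
    coeff (perP m (λ i j → a i j ∷ b i j ∷ [])) t
      ≈⟨ coeff-sumₗ (λ σ → prodP m (λ i → a i (σ i) ∷ b i (σ i) ∷ [])) (perms m) t ⟩
    sumₗ (λ σ → coeff (prodP m (λ i → a i (σ i) ∷ b i (σ i) ∷ [])) t) (perms m)
      ≈⟨ sumₗ-cong (perms m) (λ σ → coeff-prodP-linear m (aσ σ) (bσ σ) t) ⟩
    sumₗ (λ σ → sumₗ (chosenProd (aσ σ) (bσ σ)) (selections m t)) (perms m)
      ≈⟨ sumₗ-comm (λ σ → chosenProd (aσ σ) (bσ σ)) (perms m) (selections m t) ⟩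
    sumₗ (λ s → perK m (mixRows s a b)) (selections m t) ∎
    where
    aσ bσ : (Fin m → Fin m) → Fin m → Carrier
    aσ σ i = a i (σ i)
    bσ σ i = b i (σ i)

  submatrix : ∀ {k n} → Matrix n → Subset k n → Subset k n → Matrix k
  submatrix A I J i j = A (proj₁ I i) (proj₁ J j)

  Subset-removeAt : ∀ {k n} → Subset (suc k) n → Fin (suc k) → Subset k n
  Subset-removeAt (f , f-mono) i =
    f ∘ punchIn i , λ u v u<v → f-mono _ _ (punchIn-mono-< i u<v)

  Subset-full : ∀ {n} → Subset n n
  Subset-full = id , λ _ _ i<j → i<j

  MinorsVanishFrom : ∀ {n} → Matrix n → ℕ → Set ℓ
  MinorsVanishFrom {n} A k =
    ∀ {k′} → k ≤ k′ → (I J : Subset k′ n) → ¬ ¬ (perK k′ (submatrix A I J) ≈ 0#)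

  isPerRank⇒minorsVanishFrom-suc : ∀ {n} (A : Matrix n) {ρ} →
                                   IsPerRank n A ρ → MinorsVanishFrom A (suc ρ)
  isPerRank⇒minorsVanishFrom-suc A (_ , ρ-maximal) {k′} ρ<k′ I J per≉0 =
    ℕₚ.<⇒≱ ρ<k′ (ρ-maximal k′ (I , J , per≉0))

  module _ {n} (A : Matrix n) {k} (minors-vanish : MinorsVanishFrom A k) where

    -- Expand along the rows with s i ≡ true until only rows of A [ I , J ] are left.
    perK-vanishes : ∀ {m} (C : Matrix m) (s : Fin m → Bool) (I J : Subset m n) →
                    (∀ i j → s i ≡ false → C i j ≈ submatrix A I J i j) → k ≤ falseCount s →
                    ¬ ¬ (perK m C ≈ 0#)
    perK-vanishes C s I J C≈A k≤#s with Finₚ.any? (λ i → s i Boolₚ.≟ true)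
    ... | no no-true =
      ¬¬-map (trans (perK-cong (λ i j → C≈A i j (all-false i)))) (minors-vanish k≤m I J)
      where
      all-false : ∀ i → s i ≡ false
      all-false i = Boolₚ.¬-not (λ sᵢ → no-true (i , sᵢ))
      k≤m : k ≤ _
      k≤m = ≡.subst (k ≤_) (falseCount-allFalse s all-false) k≤#s
    perK-vanishes {zero}  C s I J C≈A k≤#s | yes (() , _)
    perK-vanishes {suc m} C s I J C≈A k≤#s | yes (i , sᵢ) =
      ¬¬-map (trans (perK-expand-row i C))
             (sum-¬¬0 (λ j → ¬¬-map (λ e → trans (*-congˡ e) (zeroʳ (C i j))) (minor-vanishes j)))
      where
      minor-vanishes : ∀ j → ¬ ¬ (perK m (minor C i j) ≈ 0#)
      minor-vanishes j =
        perK-vanishes (minor C i j) (s ∘ punchIn i) (Subset-removeAt I i) (Subset-removeAt J j)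
                      (λ u l → C≈A _ _) (≡.subst (k ≤_) (≡.sym (falseCount-punchIn s i sᵢ)) k≤#s)

    coeff-perP-linear-vanishes : ∀ (a b : Matrix n) → (∀ i j → a i j ≈ A i j) →
                                 ∀ t → k ℕ.+ t ≤ n →
                                 ¬ ¬ (coeff (perP n (λ i j → a i j ∷ b i j ∷ [])) t ≈ 0#)
    coeff-perP-linear-vanishes a b a≈A t k+t≤n =
      ¬¬-map (trans (coeff-perP-linear n a b t))
             (sumₗ-¬¬0 (All.map mixed-vanishes (selections-falseCount n t)))
      where
      mixed-vanishes : ∀ {s} → falseCount s ℕ.+ t ≡ n → ¬ ¬ (perK n (mixRows s a b) ≈ 0#)
      mixed-vanishes {s} #s+t≡n = perK-vanishes (mixRows s a b) s Subset-full Subset-full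
        (λ i j sᵢ → trans (reflexive (≡.cong (λ x → if x then b i j else a i j) sᵢ)) (a≈A i j))
        (ℕₚ.+-cancelʳ-≤ t k (falseCount s) (≡.subst (k ℕ.+ t ≤_) (≡.sym #s+t≡n) k+t≤n))

    -- The entries of A − xI compute to (A i j + - δ i j * 0#) ∷ (- δ i j * 1#) ∷ [].
    coeff-permPoly-vanishes : ∀ t → k ℕ.+ t ≤ n → ¬ ¬ (coeff (permPoly n A) t ≈ 0#)
    coeff-permPoly-vanishes =
      coeff-perP-linear-vanishes (λ i j → A i j + - δ i j * 0#) (λ i j → - δ i j * 1#)
                                 (λ i j → trans (+-congˡ (zeroʳ _)) (+-identityʳ _))

open import Data.Nat.Base using (_+_)

theorem1 : ∀ {c ℓ} (R : CommutativeRing c ℓ) →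
    PermanentalRank.IsField R →
    (n : ℕ) (A : Fin n → Fin n → CommutativeRing.Carrier R) (ρ η : ℕ) →
    PermanentalRank.IsPerRank R n A ρ →
    PermanentalRank.IsPerNullity R n A η →
    n ≤ ρ + η
theorem1 R _ n A ρ η rank (_ , coeff-η≉0) =
  ℕₚ.≮⇒≥ (λ ρ+η<n →
    coeff-permPoly-vanishes A (isPerRank⇒minorsVanishFrom-suc A rank) η ρ+η<n coeff-η≉0)
  where open Permanent R
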